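{- Let $\Omega$ be a partial order on the set of facets of a pure simplicial complex $\Delta$. Then the following conditions are equivalent: (i) for all facets $F,G$: if $r_\Omega(F)\subseteq G$ and $r_\Omega(G)\subseteq F$ then $F=G$; (ii) $\Delta$ is the disjoint union $\Delta=\bigsqcup_{F}[r_\Omega(F),F]$ over all facets $F$ (i.e. $\Delta$ is the union of these intervals and they are pairwise disjoint); (iii) for all facets $F,G$: if $r_\Omega(F)\subseteq G$ then $F\le_\Omega G$; (iv) for all facets $F,G$: if $F\not\ge_\Omega G$ then there exist $x\in G$ and a facet $E<_\Omega G$ such that $F\cap G\subseteq E\cap G=G\setminus\{x\}$.
   Context: A simplicial complex $\Delta$ on vertex set $V$ is a collection of subsets of $V$ containing all singletons and closed under taking subsets; its maximal faces are facets, and it is pure if all facets have the same cardinality. For a partial order $\Omega$ on the facets, the restriction of a facet $F$ is $r_\Omega(F)=\{x\in F:\exists\text{ facet }E<_\Omega F\text{ with }E\cap F=F\setminus\{x\}\}$. For sets $A\subseteq F$, $[A,F]=\{G: A\subseteq G\subseteq F\}$. -}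

module Defs where

open import Data.Nat using (ℕ)
open import Data.Fin using (Fin)
open import Data.Fin.Subset using (Subset; ⁅_⁆; _∈_; _⊆_; _∩_; _-_; ∣_∣)
open import Data.Product using (Σ; ∃; ∃-syntax; _×_; _,_)
open import Relation.Nullary using (¬_; Dec)
open import Relation.Binary.PropositionalEquality using (_≡_; _≢_)

record SimplicialComplex (n : ℕ) : Set₁ where
  field
    face      : Subset n → Set
    face?     : ∀ A → Dec (face A)
    singleton : ∀ (x : Fin n) → face ⁅ x ⁆
    downward  : ∀ {A B} → face B → A ⊆ B → face A

module _ {n : ℕ} (Δ : SimplicialComplex n) where
  open SimplicialComplex Δ

  IsFacet : Subset n → Set
  IsFacet F = face F × (∀ G → face G → F ⊆ G → G ≡ F)

  IsPure : Set
  IsPure = ∀ F G → IsFacet F → IsFacet G → ∣ F ∣ ≡ ∣ G ∣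

  -- Ω is a (decidable) partial order on the set of facets of Δ,
  -- given as a relation on subsets whose order axioms hold on facets.
  record FacetOrder (_≤Ω_ : Subset n → Subset n → Set) : Set where
    field
      dec     : ∀ F G → Dec (F ≤Ω G)
      refl    : ∀ F → IsFacet F → F ≤Ω F
      antisym : ∀ F G → IsFacet F → IsFacet G → F ≤Ω G → G ≤Ω F → F ≡ G
      trans   : ∀ F G H → IsFacet F → IsFacet G → IsFacet H →
                F ≤Ω G → G ≤Ω H → F ≤Ω H

  module _ (_≤Ω_ : Subset n → Subset n → Set) where

    _<Ω_ : Subset n → Subset n → Set
    E <Ω F = E ≤Ω F × E ≢ F

    InRestr : Subset n → Fin n → Set
    InRestr F x = x ∈ F × ∃[ E ] (IsFacet E × E <Ω F × (E ∩ F) ≡ (F - x))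

    RestrSub : Subset n → Subset n → Set
    RestrSub F G = ∀ x → InRestr F x → x ∈ G

    InInterval : Subset n → Subset n → Set
    InInterval F G = RestrSub F G × G ⊆ F

    CondI : Set
    CondI = ∀ F G → IsFacet F → IsFacet G →
            RestrSub F G → RestrSub G F → F ≡ G

    CondII : Set
    CondII =
      (∀ F G → IsFacet F → InInterval F G → face G) ×
      (∀ G → face G → ∃[ F ] (IsFacet F × InInterval F G)) ×
      (∀ F F' G → IsFacet F → IsFacet F' →
         InInterval F G → InInterval F' G → F ≡ F')

    CondIII : Set
    CondIII = ∀ F G → IsFacet F → IsFacet G → RestrSub F G → F ≤Ω G

    CondIV : Set
    CondIV = ∀ F G → IsFacet F → IsFacet G → ¬ (G ≤Ω F) →
             ∃[ x ] (x ∈ G × ∃[ E ] (IsFacet E × E <Ω G ×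
                      (F ∩ G) ⊆ (E ∩ G) × (E ∩ G) ≡ (G - x)))

-- Every face H of a facet G lies in an interval [r(F), F] with F ≤ G: if
-- some x ∈ r(G) is missing from H, then H ⊆ G ∖ {x} ⊆ E for a facet E < G,
-- and we descend to E, which terminates because there are finitely many
-- facets. Applied to H = F ∩ G this turns "r(F) ⊆ G" into a facet F' ≤ G
-- with r(F) ⊆ F' and r(F') ⊆ F, so condition (i) yields (iii); the other
-- implications are direct manipulations of the definitions.
module Submission where

open import Defs
open import Data.Nat using (ℕ)
open import Data.Fin.Subset using (Subset)
open import Data.Product using (_×_)
open import Function.Bundles using (_⇔_)

open import Data.Bool using (if_then_else_)
import Data.Bool.Properties as BoolP
open import Data.Fin using (Fin)
open import Data.Fin.Properties using (any?)
open import Data.Fin.Subset using (_∈_; _∉_; _⊆_; _⊂_; _⊃_; _∩_; _─_; _-_; inside; outside)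
open import Data.Fin.Subset.Induction using (⊃-wellFounded)
open import Data.Fin.Subset.Properties
  using (_∈?_; _⊂?_; ⊆-trans; ⊆-antisym; ⊂-irref; p⊂q⇒p⊆q; p∩q⊆p; p∩q⊆q;
         x∈p∩q⁺; ∩-comm; x∈p∧x≢y⇒x∈p-y; x∈⁅x⁆; anySubset?)
open import Data.Nat using (zero; suc; _+_; _≤_; _<_; z≤n; s≤s)
open import Data.Nat.Induction using (<-wellFounded)
open import Data.Nat.Properties using (≤-refl; +-mono-≤; +-mono-<-≤; +-mono-≤-<)
open import Data.Product using (∃-syntax; _,_; proj₁; proj₂)
open import Data.Sum using (_⊎_; inj₁; inj₂)
open import Data.Vec using ([]; _∷_; here; there)
open import Data.Vec.Properties using (≡-dec)
open import Function using (_∘_; id)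
open import Function.Bundles using (mk⇔)
open import Induction.WellFounded using (WellFounded; Acc; acc; module Subrelation)
open import Level using (Level; 0ℓ)
open import Relation.Binary using (Rel; Transitive)
import Relation.Binary.Construct.On as On
open import Relation.Binary.PropositionalEquality using (_≡_; _≢_; refl; subst; sym)
open import Relation.Nullary using (¬_; Dec; yes; no; does; contradiction)
open import Relation.Nullary.Decidable using (_×-dec_; ¬?; decidable-stable; map′)
open import Relation.Unary using (Pred; Decidable)
import Relation.Unary as U

private
  variable
    ℓ : Level
    n : ℕ

_≟_ : (p q : Subset n) → Dec (p ≡ q)
_≟_ = ≡-dec BoolP._≟_

⊆∧≢⇒⊂ : {p q : Subset n} → p ⊆ q → p ≢ q → p ⊂ q
⊆∧≢⇒⊂ {p = p} {q} p⊆q p≢q with any? (λ x → x ∈? q ×-dec ¬? (x ∈? p))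
... | yes (x , x∈q , x∉p) = p⊆q , x , x∈q , x∉p
... | no ∄x = contradiction (⊆-antisym p⊆q q⊆p) p≢q
  where
  q⊆p : q ⊆ p
  q⊆p {x} x∈q = decidable-stable (x ∈? p) (λ x∉p → ∄x (x , x∈q , x∉p))

x∈p─q⇒x∉q : ∀ (p q : Subset n) {x} → x ∈ p ─ q → x ∉ q
x∈p─q⇒x∉q (_ ∷ p) (inside ∷ q) ()        here
x∈p─q⇒x∉q (_ ∷ p) (_ ∷ q)      (there x∈) (there x∈q) = x∈p─q⇒x∉q p q x∈ x∈q

x∉p-x : ∀ (p : Subset n) x → x ∉ p - x
x∉p-x p x x∈ = x∈p─q⇒x∉q p _ x∈ (x∈⁅x⁆ x)

p⊆q∧x∉p⇒p⊆q-x : {p q : Subset n} {x : Fin n} → p ⊆ q → x ∉ p → p ⊆ q - x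
p⊆q∧x∉p⇒p⊆q-x p⊆q x∉p y∈p = x∈p∧x≢y⇒x∈p-y (p⊆q y∈p) (λ { refl → x∉p y∈p })

count : {P : Pred (Subset n) ℓ} → Decidable P → ℕ
count {n = zero}  P? = if does (P? []) then 1 else 0
count {n = suc n} P? = count (P? ∘ (inside ∷_)) + count (P? ∘ (outside ∷_))

count-mono : {P Q : Pred (Subset n) ℓ} (P? : Decidable P) (Q? : Decidable Q) →
             P U.⊆ Q → count P? ≤ count Q?
count-mono {n = zero} P? Q? P⊆Q with P? [] | Q? []
... | yes _ | yes _  = ≤-refl
... | yes p | no ¬q  = contradiction (P⊆Q p) ¬q
... | no _  | _      = z≤n
count-mono {n = suc n} P? Q? P⊆Q =
  +-mono-≤ (count-mono (P? ∘ (inside ∷_)) (Q? ∘ (inside ∷_)) P⊆Q)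
           (count-mono (P? ∘ (outside ∷_)) (Q? ∘ (outside ∷_)) P⊆Q)

count-< : {P Q : Pred (Subset n) ℓ} (P? : Decidable P) (Q? : Decidable Q) →
          P U.⊆ Q → ∀ y → Q y → ¬ P y → count P? < count Q?
count-< {n = zero} P? Q? P⊆Q [] q ¬p with P? [] | Q? []
... | yes p | _     = contradiction p ¬p
... | no _  | yes _ = s≤s z≤n
... | no _  | no ¬q = contradiction q ¬q
count-< {n = suc n} P? Q? P⊆Q (inside ∷ y) q ¬p =
  +-mono-<-≤ (count-< (P? ∘ (inside ∷_)) (Q? ∘ (inside ∷_)) P⊆Q y q ¬p)
             (count-mono (P? ∘ (outside ∷_)) (Q? ∘ (outside ∷_)) P⊆Q)
count-< {n = suc n} P? Q? P⊆Q (outside ∷ y) q ¬p =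
  +-mono-≤-< (count-mono (P? ∘ (inside ∷_)) (Q? ∘ (inside ∷_)) P⊆Q)
             (count-< (P? ∘ (outside ∷_)) (Q? ∘ (outside ∷_)) P⊆Q y q ¬p)

finite-strictOrder-wellFounded :
  {_⊏_ : Rel (Subset n) ℓ} → (∀ p q → Dec (p ⊏ q)) →
  (∀ {p} → ¬ p ⊏ p) → Transitive _⊏_ → WellFounded _⊏_
finite-strictOrder-wellFounded {_⊏_ = _⊏_} _⊏?_ irrefl trans =
  Subrelation.wellFounded below-count-< (On.wellFounded below-count <-wellFounded)
  where
  below-count : Subset _ → ℕ
  below-count q = count (_⊏? q)

  below-count-< : ∀ {p q} → p ⊏ q → below-count p < below-count q
  below-count-< {p} {q} p⊏q = count-< (_⊏? p) (_⊏? q) (λ r⊏p → trans r⊏p p⊏q) p p⊏q irrefl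

module FacetProperties (Δ : SimplicialComplex n) where
  open SimplicialComplex Δ

  HasProperSuperface : Subset n → Set
  HasProperSuperface G = ∃[ H ] (face H × G ⊂ H)

  hasProperSuperface? : ∀ G → Dec (HasProperSuperface G)
  hasProperSuperface? G = anySubset? (λ H → face? H ×-dec G ⊂? H)

  facet⇒¬hasProperSuperface : ∀ {G} → IsFacet Δ G → ¬ HasProperSuperface G
  facet⇒¬hasProperSuperface (_ , maximal) (H , fH , G⊂H) =
    ⊂-irref (sym (maximal H fH (p⊂q⇒p⊆q G⊂H))) G⊂H

  ¬hasProperSuperface⇒facet : ∀ {G} → face G → ¬ HasProperSuperface G → IsFacet Δ G
  ¬hasProperSuperface⇒facet {G} fG ∄H = fG , λ H fH G⊆H →
    decidable-stable (H ≟ G) (λ H≢G → ∄H (H , fH , ⊆∧≢⇒⊂ G⊆H (H≢G ∘ sym)))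

  isFacet? : ∀ G → Dec (IsFacet Δ G)
  isFacet? G = map′ (λ (fG , ∄H) → ¬hasProperSuperface⇒facet fG ∄H)
                    (λ fG → proj₁ fG , facet⇒¬hasProperSuperface fG)
                    (face? G ×-dec ¬? (hasProperSuperface? G))

  face⊆facet : ∀ {G} → face G → ∃[ F ] (IsFacet Δ F × G ⊆ F)
  face⊆facet {G} = extend (⊃-wellFounded G)
    where
    extend : ∀ {G} → Acc _⊃_ G → face G → ∃[ F ] (IsFacet Δ F × G ⊆ F)
    extend {G} (acc larger) fG with hasProperSuperface? G
    ... | no ∄H = G , ¬hasProperSuperface⇒facet fG ∄H , id
    ... | yes (H , fH , G⊂H) with extend (larger G⊂H) fH
    ...   | F , fF , H⊆F = F , fF , ⊆-trans (p⊂q⇒p⊆q G⊂H) H⊆F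

module RestrictionIntervals (Δ : SimplicialComplex n) (_≤Ω_ : Subset n → Subset n → Set)
                            (Ω : FacetOrder Δ _≤Ω_) where
  open SimplicialComplex Δ
  open FacetOrder Ω using (dec)
    renaming (refl to ≤Ω-refl; antisym to ≤Ω-antisym; trans to ≤Ω-trans)
  open FacetProperties Δ

  _⊏_ : Rel (Subset n) 0ℓ
  E ⊏ G = IsFacet Δ E × IsFacet Δ G × _<Ω_ Δ _≤Ω_ E G

  ⊏-irrefl : ∀ {G} → ¬ G ⊏ G
  ⊏-irrefl (_ , _ , _ , G≢G) = G≢G refl

  ⊏-trans : Transitive _⊏_
  ⊏-trans {E} {G} {K} (fE , fG , E≤G , _) (_ , fK , G≤K , G≢K) =
    fE , fK , ≤Ω-trans E G K fE fG fK E≤G G≤K , E≢K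
    where
    E≢K : E ≢ K
    E≢K refl = G≢K (≤Ω-antisym G E fG fE G≤K E≤G)

  _⊏?_ : ∀ E G → Dec (E ⊏ G)
  E ⊏? G = isFacet? E ×-dec isFacet? G ×-dec dec E G ×-dec ¬? (E ≟ G)

  ⊏-wellFounded : WellFounded _⊏_
  ⊏-wellFounded = finite-strictOrder-wellFounded _⊏?_ ⊏-irrefl ⊏-trans

  inRestr? : ∀ F x → Dec (InRestr Δ _≤Ω_ F x)
  inRestr? F x = x ∈? F ×-dec anySubset? (λ E →
    isFacet? E ×-dec (dec E F ×-dec ¬? (E ≟ F)) ×-dec (E ∩ F) ≟ (F - x))

  restrSub⊎escape : ∀ G H → RestrSub Δ _≤Ω_ G H ⊎ ∃[ x ] (InRestr Δ _≤Ω_ G x × x ∉ H)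
  restrSub⊎escape G H with any? (λ x → inRestr? G x ×-dec ¬? (x ∈? H))
  ... | yes escape = inj₂ escape
  ... | no ∄x = inj₁ λ x r → decidable-stable (x ∈? H) (λ x∉H → ∄x (x , r , x∉H))

  restrSub-⊆ : ∀ {F H K} → RestrSub Δ _≤Ω_ F H → H ⊆ K → RestrSub Δ _≤Ω_ F K
  restrSub-⊆ rF⊆H H⊆K x r = H⊆K (rF⊆H x r)

  adjacent-below-containing : ∀ {G H x} → H ⊆ G → InRestr Δ _≤Ω_ G x → x ∉ H →
    ∃[ E ] (IsFacet Δ E × _<Ω_ Δ _≤Ω_ E G × H ⊆ E ∩ G × (E ∩ G) ≡ (G - x))
  adjacent-below-containing {H = H} H⊆G (_ , E , fE , E<G , E∩G≡G-x) x∉H =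
    E , fE , E<G , subst (H ⊆_) (sym E∩G≡G-x) (p⊆q∧x∉p⇒p⊆q-x H⊆G x∉H) , E∩G≡G-x

  subface-in-lower-interval : ∀ {G H} → IsFacet Δ G → H ⊆ G →
    ∃[ F ] (IsFacet Δ F × F ≤Ω G × InInterval Δ _≤Ω_ F H)
  subface-in-lower-interval {G} = descend (⊏-wellFounded G)
    where
    descend : ∀ {G H} → Acc _⊏_ G → IsFacet Δ G → H ⊆ G →
              ∃[ F ] (IsFacet Δ F × F ≤Ω G × InInterval Δ _≤Ω_ F H)
    descend {G} {H} (acc below) fG H⊆G with restrSub⊎escape G H
    ... | inj₁ rG⊆H = G , fG , ≤Ω-refl G fG , rG⊆H , H⊆G
    ... | inj₂ (x , x∈rG , x∉H) with adjacent-below-containing H⊆G x∈rG x∉H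
    ...   | E , fE , E<G , H⊆E∩G , _
          with descend (below (fE , fG , E<G)) fE (⊆-trans H⊆E∩G (p∩q⊆p E G))
    ...     | F , fF , F≤E , H∈[rF,F] =
      F , fF , ≤Ω-trans F E G fF fE fG F≤E (proj₁ E<G) , H∈[rF,F]

  ∩-∈-interval : ∀ {F G} → RestrSub Δ _≤Ω_ F G → InInterval Δ _≤Ω_ F (F ∩ G)
  ∩-∈-interval {F} {G} rF⊆G = (λ x r → x∈p∩q⁺ (proj₁ r , rF⊆G x r)) , p∩q⊆p F G

  I⇒III : CondI Δ _≤Ω_ → CondIII Δ _≤Ω_
  I⇒III condI F G fF fG rF⊆G with subface-in-lower-interval fG (p∩q⊆q F G)
  ... | F' , fF' , F'≤G , rF'⊆F∩G , F∩G⊆F' = subst (_≤Ω G) (sym F≡F') F'≤G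
    where
    F≡F' : F ≡ F'
    F≡F' = condI F F' fF fF' (restrSub-⊆ (proj₁ (∩-∈-interval rF⊆G)) F∩G⊆F')
                             (restrSub-⊆ rF'⊆F∩G (p∩q⊆p F G))

  III⇒I : CondIII Δ _≤Ω_ → CondI Δ _≤Ω_
  III⇒I condIII F G fF fG rF⊆G rG⊆F =
    ≤Ω-antisym F G fF fG (condIII F G fF fG rF⊆G) (condIII G F fG fF rG⊆F)

  III⇒IV : CondIII Δ _≤Ω_ → CondIV Δ _≤Ω_
  III⇒IV condIII F G fF fG G≰F with restrSub⊎escape G F
  ... | inj₁ rG⊆F = contradiction (condIII G F fG fF rG⊆F) G≰F
  ... | inj₂ (x , x∈rG , x∉F) =
    x , proj₁ x∈rG , adjacent-below-containing (p∩q⊆q F G) x∈rG (x∉F ∘ p∩q⊆p F G)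

  IV⇒III : CondIV Δ _≤Ω_ → CondIII Δ _≤Ω_
  IV⇒III condIV F G fF fG rF⊆G with dec F G
  ... | yes F≤G = F≤G
  ... | no F≰G with condIV G F fG fF F≰G
  ...   | x , x∈F , E , fE , E<F , G∩F⊆E∩F , E∩F≡F-x =
    contradiction (subst (x ∈_) E∩F≡F-x (G∩F⊆E∩F (x∈p∩q⁺ (x∈G , x∈F)))) (x∉p-x F x)
    where
    x∈G : x ∈ G
    x∈G = rF⊆G x (x∈F , E , fE , E<F , E∩F≡F-x)

  I⇒II : CondI Δ _≤Ω_ → CondII Δ _≤Ω_
  I⇒II condI = (λ F G fF G∈[rF,F] → downward (proj₁ fF) (proj₂ G∈[rF,F])) , covered , disjoint
    where
    covered : ∀ G → face G → ∃[ F ] (IsFacet Δ F × InInterval Δ _≤Ω_ F G)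
    covered G fG with face⊆facet fG
    ... | F , fF , G⊆F with subface-in-lower-interval fF G⊆F
    ...   | F' , fF' , _ , G∈[rF',F'] = F' , fF' , G∈[rF',F']

    disjoint : ∀ F F' G → IsFacet Δ F → IsFacet Δ F' →
               InInterval Δ _≤Ω_ F G → InInterval Δ _≤Ω_ F' G → F ≡ F'
    disjoint F F' G fF fF' (rF⊆G , G⊆F) (rF'⊆G , G⊆F') =
      condI F F' fF fF' (restrSub-⊆ rF⊆G G⊆F') (restrSub-⊆ rF'⊆G G⊆F)

  II⇒I : CondII Δ _≤Ω_ → CondI Δ _≤Ω_
  II⇒I (_ , _ , disjoint) F G fF fG rF⊆G rG⊆F =
    disjoint F G (F ∩ G) fF fG (∩-∈-interval rF⊆G)
      (subst (InInterval Δ _≤Ω_ G) (∩-comm G F) (∩-∈-interval rG⊆F))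

theorem3p1 : ∀ {n : ℕ} (Δ : SimplicialComplex n) → IsPure Δ →
    (_≤Ω_ : Subset n → Subset n → Set) → FacetOrder Δ _≤Ω_ →
    (CondI Δ _≤Ω_ ⇔ CondII Δ _≤Ω_) ×
    (CondI Δ _≤Ω_ ⇔ CondIII Δ _≤Ω_) ×
    (CondI Δ _≤Ω_ ⇔ CondIV Δ _≤Ω_)
theorem3p1 Δ _ _≤Ω_ Ω =
  mk⇔ I⇒II II⇒I , mk⇔ I⇒III III⇒I , mk⇔ (III⇒IV ∘ I⇒III) (III⇒I ∘ IV⇒III)
  where open RestrictionIntervals Δ _≤Ω_ Ω
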